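{- The functions $F_m(y)$ are rational of the form $P_m(y)/Q_m(y)$, where $P_m(y)$ and $Q_m(y)$ are polynomials with $m=\deg Q_m = 1+\deg P_m$. In particular, $P_1=1$, $Q_1=1-y$, $P_2 = 1+y$, $Q_2 =1-y-y^2$, and for all $m\geq 1$ we have \[ \left[\begin{array}{cc} 1 & y \\ -y & 1-y^2 \end{array} \right] \left[ \begin{array}{c} P_m(y) \\ Q_m(y) \end{array} \right] = \left[ \begin{array}{c} P_{m+2}(y) \\ Q_{m+2}(y) \end{array} \right]. \]
   Context: For $n\geq 1$ and $m\geq 1$, let $\Omega_n(m)$ denote the zig-zag order polynomial, i.e., the number of functions $f:[n]\to\{1,2,\ldots,m\}$ satisfying $f(1)\leq f(2)\geq f(3)\leq f(4)\geq \cdots$ (the order polynomial of a natural labeling of the zig-zag poset on $n$ elements); set $\Omega_0(m)=1$. For fixed $m\geq 1$, define the ordinary generating function $F_m(y)=\sum_{n\geq 0}\Omega_n(m)\,y^n$. Thus $F_1(y)=1/(1-y)$, and for all $m\geq 2$ one has $F_m(y)=\dfrac{1}{F_{m-1}(-y)-y}$ and $F_m(y)=\dfrac{y+2F_{m-1}(y)}{2-y^2-yF_{m-1}(y)}$, which imply $F_m(y)=\dfrac{y+F_{m-2}(y)}{1-y^2-yF_{m-2}(y)}$. -}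

module Defs where

open import Data.Nat using (ℕ; zero; suc; _≤ᵇ_)
open import Data.Bool using (Bool; true; false; _∧_)
open import Data.List using (List; []; _∷_; map; concatMap; upTo)
open import Relation.Binary.PropositionalEquality using (_≡_)
open import Relation.Nullary using (¬_)
open import Data.Product using (_×_)
open import Data.Nat using (_<_)
open import Data.Integer using (ℤ; +_; _+_; _*_; -_)

vals : ℕ → List ℕ
vals m = map suc (upTo m)

-- all functions [n] → {1,...,m}, each listed as its sequence of values
-- (f(1), f(2), ..., f(n))
allFns : ℕ → ℕ → List (List ℕ)
allFns zero    m = [] ∷ []
allFns (suc n) m = concatMap (λ x → map (x ∷_) (allFns n m)) (vals m)

zigUp   : List ℕ → Bool
zigDown : List ℕ → Bool
zigUp   (x ∷ y ∷ r) = (x ≤ᵇ y) ∧ zigDown (y ∷ r)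
zigUp   _           = true
zigDown (x ∷ y ∷ r) = (y ≤ᵇ x) ∧ zigUp (y ∷ r)
zigDown _           = true

count : {A : Set} → (A → Bool) → List A → ℕ
count p []       = 0
count p (x ∷ xs) with p x
... | true  = suc (count p xs)
... | false = count p xs

Ω : ℕ → ℕ → ℕ
Ω n m = count zigUp (allFns n m)

Series : Set
Series = ℕ → ℤ

F : ℕ → Series
F m n = + Ω n m

sumTo : ℕ → (ℕ → ℤ) → ℤ
sumTo zero    g = g 0
sumTo (suc n) g = sumTo n g + g (suc n)

_⊛_ : Series → Series → Series
(p ⊛ q) n = sumTo n (λ k → p k * q (n Data.Nat.∸ k))

infixl 7 _⊛_

_⊕_ : Series → Series → Series
(p ⊕ q) n = p n + q n

infixl 6 _⊕_

⊖_ : Series → Series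
(⊖ p) n = - p n

poly : List ℤ → Series
poly []       n       = + 0
poly (a ∷ as) zero    = a
poly (a ∷ as) (suc n) = poly as n

Y : Series
Y = poly (+ 0 ∷ + 1 ∷ [])

_≐_ : Series → Series → Set
p ≐ q = ∀ n → p n ≡ q n

infix 4 _≐_

HasDegree : Series → ℕ → Set
HasDegree p d = (¬ p d ≡ + 0) × (∀ k → d < k → p k ≡ + 0)

module Submission where

open import Defs
open import Data.Nat using (ℕ; suc; _≥_; _∸_)
open import Data.Integer using (+_; -_)
open import Data.List using (List; []; _∷_)
open import Data.Product using (Σ; _×_)

open import Data.Nat as ℕ using (zero; _≤_; _<_; z≤n; s≤s)
import Data.Nat.Properties as ℕ
open import Data.Product using (_,_)
open import Function using (_∘_)
open import Relation.Binary.PropositionalEquality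

-- Cut a zig-zag word over {1, …, k + 1} at the first occurrence of its largest
-- letter k + 1.  That letter must sit at a peak, which fixes the parity of the
-- prefix; since x ↦ k + 2 - x exchanges the patterns ≤ ≥ ≤ ⋯ and ≥ ≤ ≥ ⋯, adding
-- the counts for both patterns removes the parity condition and gives
--   F (k + 1) · (2 - y² - y F k) = y + 2 F k.
-- Eliminating F (m + 1) between two consecutive instances and cancelling the
-- factor 4 - y² gives F (m + 2) · (1 - y² - y F m) = y + F m, and multiplying this
-- by Q m turns Q m F m = P m into Q (m + 2) F (m + 2) = P (m + 2).  The degrees
-- follow from the recurrence, the leading coefficient of Q m being the leading
-- coefficient of P (m + 2) and, up to sign, of Q (m + 2).

module ZigZagWords where

  open import Data.Nat using (_+_; _*_; _≤ᵇ_)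
  open import Data.Nat.Tactic.RingSolver using (solve-∀)
  open import Data.Bool using (Bool; true; false; _∧_; not)
  import Data.Bool.Properties as Bool
  open import Data.List using (map; concat; upTo; applyUpTo; _++_; length)
  open import Data.List.Relation.Unary.All using (All; []; _∷_)
  open import Relation.Nullary.Reflects using (det; fromEquivalence; ofʸ; ofⁿ)

  𝟙 : Bool → ℕ
  𝟙 true  = 1
  𝟙 false = 0

  𝟙-∧ : ∀ a b → 𝟙 (a ∧ b) ≡ 𝟙 a * 𝟙 b
  𝟙-∧ true  b = sym (ℕ.+-identityʳ (𝟙 b))
  𝟙-∧ false b = refl

  sumOver : {A : Set} → List A → (A → ℕ) → ℕ
  sumOver []       g = 0
  sumOver (x ∷ xs) g = g x + sumOver xs g

  count≡sumOver : {A : Set} (p : A → Bool) (xs : List A) → count p xs ≡ sumOver xs (𝟙 ∘ p)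
  count≡sumOver p []       = refl
  count≡sumOver p (x ∷ xs) with p x
  ... | true  = cong suc (count≡sumOver p xs)
  ... | false = count≡sumOver p xs

  sumOver-cong : {A : Set} (xs : List A) {g h : A → ℕ} → (∀ x → g x ≡ h x) → sumOver xs g ≡ sumOver xs h
  sumOver-cong []       g≗h = refl
  sumOver-cong (x ∷ xs) g≗h = cong₂ _+_ (g≗h x) (sumOver-cong xs g≗h)

  sumOver-++ : {A : Set} (xs ys : List A) (g : A → ℕ) → sumOver (xs ++ ys) g ≡ sumOver xs g + sumOver ys g
  sumOver-++ []       ys g = refl
  sumOver-++ (x ∷ xs) ys g = trans (cong (_+_ (g x)) (sumOver-++ xs ys g)) (sym (ℕ.+-assoc (g x) _ _))

  sumOver-map : {A B : Set} (f : A → B) (xs : List A) (g : B → ℕ) → sumOver (map f xs) g ≡ sumOver xs (g ∘ f)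
  sumOver-map f []       g = refl
  sumOver-map f (x ∷ xs) g = cong (_+_ (g (f x))) (sumOver-map f xs g)

  sumOver-concat : {A : Set} (xss : List (List A)) (g : A → ℕ) →
    sumOver (concat xss) g ≡ sumOver xss (λ xs → sumOver xs g)
  sumOver-concat []         g = refl
  sumOver-concat (xs ∷ xss) g = trans (sumOver-++ xs (concat xss) g) (cong (_+_ (sumOver xs g)) (sumOver-concat xss g))

  sumOver-applyUpTo-last : ∀ (f : ℕ → ℕ) m (g : ℕ → ℕ) →
    sumOver (applyUpTo f (suc m)) g ≡ sumOver (applyUpTo f m) g + g (f m)
  sumOver-applyUpTo-last f zero    g = ℕ.+-comm (g (f 0)) 0
  sumOver-applyUpTo-last f (suc m) g = trans (cong (_+_ (g (f 0))) (sumOver-applyUpTo-last (f ∘ suc) m g))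
    (sym (ℕ.+-assoc (g (f 0)) _ _))

  sumVals : ℕ → (ℕ → ℕ) → ℕ
  sumVals zero    f = 0
  sumVals (suc m) f = sumVals m f + f (suc m)

  sumOver-vals : ∀ m g → sumOver (vals m) g ≡ sumVals m g
  sumOver-vals m g = trans (sumOver-map suc (upTo m) g) (sumOver-upTo m)
    where
    sumOver-upTo : ∀ m → sumOver (upTo m) (g ∘ suc) ≡ sumVals m g
    sumOver-upTo zero    = refl
    sumOver-upTo (suc m) =
      trans (sumOver-applyUpTo-last (λ i → i) m (g ∘ suc)) (cong (_+ g (suc m)) (sumOver-upTo m))

  sumVals-cong : ∀ m {f g} → (∀ x → f x ≡ g x) → sumVals m f ≡ sumVals m g
  sumVals-cong zero    f≗g = refl
  sumVals-cong (suc m) f≗g = cong₂ _+_ (sumVals-cong m f≗g) (f≗g (suc m))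

  sumVals-cong-≤ : ∀ m {f g} → (∀ x → x ≤ m → f x ≡ g x) → sumVals m f ≡ sumVals m g
  sumVals-cong-≤ zero    f≗g = refl
  sumVals-cong-≤ (suc m) f≗g =
    cong₂ _+_ (sumVals-cong-≤ m (λ x x≤m → f≗g x (ℕ.m≤n⇒m≤1+n x≤m))) (f≗g (suc m) ℕ.≤-refl)

  sumVals-+ : ∀ m f g → sumVals m (λ x → f x + g x) ≡ sumVals m f + sumVals m g
  sumVals-+ zero    f g = refl
  sumVals-+ (suc m) f g = trans (cong (_+ (f (suc m) + g (suc m))) (sumVals-+ m f g))
    (+-interchange (sumVals m f) (sumVals m g) (f (suc m)) (g (suc m)))
    where
    +-interchange : ∀ a b c d → a + b + (c + d) ≡ a + c + (b + d)
    +-interchange = solve-∀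

  sumVals-*ˡ : ∀ m c f → sumVals m (λ x → c * f x) ≡ c * sumVals m f
  sumVals-*ˡ zero    c f = sym (ℕ.*-zeroʳ c)
  sumVals-*ˡ (suc m) c f = trans (cong (_+ c * f (suc m)) (sumVals-*ˡ m c f))
    (sym (ℕ.*-distribˡ-+ c (sumVals m f) (f (suc m))))

  sumVals-zero : ∀ m → sumVals m (λ _ → 0) ≡ 0
  sumVals-zero zero    = refl
  sumVals-zero (suc m) = trans (ℕ.+-identityʳ _) (sumVals-zero m)

  sumVals-unfoldˡ : ∀ m f → sumVals (suc m) f ≡ f 1 + sumVals m (f ∘ suc)
  sumVals-unfoldˡ zero    f = ℕ.+-comm 0 (f 1)
  sumVals-unfoldˡ (suc m) f = trans (cong (_+ f (suc (suc m))) (sumVals-unfoldˡ m f)) (ℕ.+-assoc (f 1) _ _)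

  reflect : ℕ → ℕ → ℕ
  reflect m x = suc m ∸ x

  sumVals-reflect : ∀ m f → sumVals m f ≡ sumVals m (f ∘ reflect m)
  sumVals-reflect zero    f = refl
  sumVals-reflect (suc m) f = begin
    sumVals (suc m) f                                 ≡⟨ sumVals-unfoldˡ m f ⟩
    f 1 + sumVals m (f ∘ suc)                         ≡⟨ cong (_+_ (f 1)) (sumVals-reflect m (f ∘ suc)) ⟩
    f 1 + sumVals m (λ x → f (suc (suc m ∸ x)))       ≡⟨ cong (_+_ (f 1)) (sumVals-cong-≤ m (λ x x≤m →
                                                           cong f (sym (ℕ.+-∸-assoc 1 (ℕ.m≤n⇒m≤1+n x≤m))))) ⟩
    f 1 + sumVals m (λ x → f (suc (suc m) ∸ x))       ≡⟨ ℕ.+-comm (f 1) _ ⟩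
    sumVals m (λ x → f (suc (suc m) ∸ x)) + f 1       ≡⟨ cong (λ i → sumVals m (λ x → f (suc (suc m) ∸ x)) + f i)
                                                           (sym (ℕ.m+n∸n≡m 1 (suc m))) ⟩
    sumVals (suc m) (f ∘ reflect (suc m))             ∎
    where open ≡-Reasoning

  sumWords : ℕ → ℕ → (List ℕ → ℕ) → ℕ
  sumWords zero    m g = g []
  sumWords (suc n) m g = sumVals m (λ x → sumWords n m (g ∘ (x ∷_)))

  sumOver-allFns : ∀ n m g → sumOver (allFns n m) g ≡ sumWords n m g
  sumOver-allFns zero    m g = ℕ.+-identityʳ (g [])
  sumOver-allFns (suc n) m g = begin
    sumOver (concat (map (λ x → map (x ∷_) (allFns n m)) (vals m))) g
      ≡⟨ sumOver-concat (map (λ x → map (x ∷_) (allFns n m)) (vals m)) g ⟩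
    sumOver (map (λ x → map (x ∷_) (allFns n m)) (vals m)) (λ xs → sumOver xs g)
      ≡⟨ sumOver-map _ (vals m) _ ⟩
    sumOver (vals m) (λ x → sumOver (map (x ∷_) (allFns n m)) g)
      ≡⟨ sumOver-cong (vals m) (λ x → trans (sumOver-map (x ∷_) (allFns n m) g) (sumOver-allFns n m (g ∘ (x ∷_)))) ⟩
    sumOver (vals m) (λ x → sumWords n m (g ∘ (x ∷_)))
      ≡⟨ sumOver-vals m _ ⟩
    sumWords (suc n) m g ∎
    where open ≡-Reasoning

  sumWords-cong : ∀ n m {g h} → (∀ w → g w ≡ h w) → sumWords n m g ≡ sumWords n m h
  sumWords-cong zero    m g≗h = g≗h []
  sumWords-cong (suc n) m g≗h = sumVals-cong m (λ x → sumWords-cong n m (λ w → g≗h (x ∷ w)))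

  sumWords-cong-≤ : ∀ n m {g h} → (∀ w → All (_≤ m) w → g w ≡ h w) → sumWords n m g ≡ sumWords n m h
  sumWords-cong-≤ zero    m g≗h = g≗h [] []
  sumWords-cong-≤ (suc n) m g≗h =
    sumVals-cong-≤ m (λ x x≤m → sumWords-cong-≤ n m (λ w w≤m → g≗h (x ∷ w) (x≤m ∷ w≤m)))

  sumWords-*ˡ : ∀ n m c g → sumWords n m (λ w → c * g w) ≡ c * sumWords n m g
  sumWords-*ˡ zero    m c g = refl
  sumWords-*ˡ (suc n) m c g =
    trans (sumVals-cong m (λ x → sumWords-*ˡ n m c (g ∘ (x ∷_)))) (sumVals-*ˡ m c _)

  sumWords-*ʳ : ∀ n m c g → sumWords n m (λ w → g w * c) ≡ sumWords n m g * c
  sumWords-*ʳ n m c g =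
    trans (sumWords-cong n m (λ w → ℕ.*-comm (g w) c)) (trans (sumWords-*ˡ n m c g) (ℕ.*-comm c _))

  sumWords-zero : ∀ n m → sumWords n m (λ _ → 0) ≡ 0
  sumWords-zero zero    m = refl
  sumWords-zero (suc n) m = trans (sumVals-cong m (λ x → sumWords-zero n m)) (sumVals-zero m)

  sumWords-length : ∀ n m (h : ℕ → List ℕ → ℕ) → sumWords n m (λ w → h (length w) w) ≡ sumWords n m (h n)
  sumWords-length zero    m h = refl
  sumWords-length (suc n) m h = sumVals-cong m (λ x → sumWords-length n m (λ k w → h (suc k) (x ∷ w)))

  sumWords-reflect : ∀ n m g → sumWords n m g ≡ sumWords n m (g ∘ map (reflect m))
  sumWords-reflect zero    m g = refl
  sumWords-reflect (suc n) m g = trans (sumVals-cong m (λ x → sumWords-reflect n m (g ∘ (x ∷_))))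
    (sumVals-reflect m (λ x → sumWords n m (g ∘ (x ∷_) ∘ map (reflect m))))

  ups downs : ℕ → ℕ → ℕ
  ups   n m = sumWords n m (𝟙 ∘ zigUp)
  downs n m = sumWords n m (𝟙 ∘ zigDown)

  Ω≡ups : ∀ n m → Ω n m ≡ ups n m
  Ω≡ups n m = trans (count≡sumOver zigUp (allFns n m)) (sumOver-allFns n m _)

  ≤ᵇ-reflect : ∀ m x y → x ≤ suc m → (reflect m y ≤ᵇ reflect m x) ≡ (x ≤ᵇ y)
  ≤ᵇ-reflect m x y x≤1+m = det (ℕ.≤ᵇ-reflects-≤ (reflect m y) (reflect m x))
    (fromEquivalence (λ x≤ᵇy → ℕ.∸-monoʳ-≤ (suc m) (ℕ.≤ᵇ⇒≤ x y x≤ᵇy))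
                     (λ ry≤rx → ℕ.≤⇒≤ᵇ (ℕ.∸-cancelʳ-≤ x≤1+m ry≤rx)))

  zigUp-reflect   : ∀ m w → All (_≤ m) w → zigUp (map (reflect m) w) ≡ zigDown w
  zigDown-reflect : ∀ m w → All (_≤ m) w → zigDown (map (reflect m) w) ≡ zigUp w
  zigUp-reflect m []          _ = refl
  zigUp-reflect m (x ∷ [])    _ = refl
  zigUp-reflect m (x ∷ y ∷ w) (x≤m ∷ y≤m ∷ w≤m) =
    cong₂ _∧_ (≤ᵇ-reflect m y x (ℕ.m≤n⇒m≤1+n y≤m)) (zigDown-reflect m (y ∷ w) (y≤m ∷ w≤m))
  zigDown-reflect m []          _ = refl
  zigDown-reflect m (x ∷ [])    _ = refl
  zigDown-reflect m (x ∷ y ∷ w) (x≤m ∷ y≤m ∷ w≤m) =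
    cong₂ _∧_ (≤ᵇ-reflect m x y (ℕ.m≤n⇒m≤1+n x≤m)) (zigUp-reflect m (y ∷ w) (y≤m ∷ w≤m))

  downs≡ups : ∀ n m → downs n m ≡ ups n m
  downs≡ups n m = trans (sumWords-reflect n m (𝟙 ∘ zigDown))
    (sumWords-cong-≤ n m (λ w w≤m → cong 𝟙 (zigDown-reflect m w w≤m)))

  odd : ℕ → Bool
  odd zero    = false
  odd (suc n) = not (odd n)

  ≤ᵇ-true : ∀ {x y} → x ≤ y → (x ≤ᵇ y) ≡ true
  ≤ᵇ-true {x} {y} x≤y = det (ℕ.≤ᵇ-reflects-≤ x y) (ofʸ x≤y)

  ≤ᵇ-false : ∀ {x y} → y < x → (x ≤ᵇ y) ≡ false
  ≤ᵇ-false {x} {y} y<x = det (ℕ.≤ᵇ-reflects-≤ x y) (ofⁿ (ℕ.<⇒≱ y<x))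

  zigDown-top : ∀ M w → All (_≤ M) w → zigDown (M ∷ w) ≡ zigUp w
  zigDown-top M []      _           = refl
  zigDown-top M (y ∷ w) (y≤M ∷ _) = cong (_∧ zigUp (y ∷ w)) (≤ᵇ-true y≤M)

  ∧-shuffle : ∀ a b c d → a ∧ ((b ∧ c) ∧ d) ≡ (b ∧ (a ∧ c)) ∧ d
  ∧-shuffle true  b     c d = refl
  ∧-shuffle false true  c d = refl
  ∧-shuffle false false c d = refl

  -- A letter above all letters of the nonempty prefix x ∷ u can only sit at a peak,
  -- so the parity of the length of x ∷ u is forced.
  zigUp-around-top : ∀ k x u w → All (_≤ k) (x ∷ u) →
    zigUp (x ∷ u ++ suc k ∷ w) ≡ (odd (length (x ∷ u)) ∧ zigUp (x ∷ u)) ∧ zigDown (suc k ∷ w)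
  zigDown-around-top : ∀ k x u w → All (_≤ k) (x ∷ u) →
    zigDown (x ∷ u ++ suc k ∷ w) ≡ (not (odd (length (x ∷ u))) ∧ zigDown (x ∷ u)) ∧ zigDown (suc k ∷ w)
  zigUp-around-top k x [] w (x≤k ∷ _) = cong (_∧ zigDown (suc k ∷ w)) (≤ᵇ-true (ℕ.m≤n⇒m≤1+n x≤k))
  zigUp-around-top k x (y ∷ u) w (_ ∷ yu≤k) = trans (cong ((x ≤ᵇ y) ∧_) (zigDown-around-top k y u w yu≤k))
    (∧-shuffle (x ≤ᵇ y) (not (odd (length (y ∷ u)))) (zigDown (y ∷ u)) (zigDown (suc k ∷ w)))
  zigDown-around-top k x [] w (x≤k ∷ _) = cong (_∧ zigUp (suc k ∷ w)) (≤ᵇ-false (s≤s x≤k))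
  zigDown-around-top k x (y ∷ u) w (_ ∷ yu≤k) = begin
    (y ≤ᵇ x) ∧ zigUp (y ∷ u ++ suc k ∷ w)
      ≡⟨ cong ((y ≤ᵇ x) ∧_) (zigUp-around-top k y u w yu≤k) ⟩
    (y ≤ᵇ x) ∧ ((odd (length (y ∷ u)) ∧ zigUp (y ∷ u)) ∧ zigDown (suc k ∷ w))
      ≡⟨ ∧-shuffle (y ≤ᵇ x) (odd (length (y ∷ u))) (zigUp (y ∷ u)) (zigDown (suc k ∷ w)) ⟩
    (odd (length (y ∷ u)) ∧ ((y ≤ᵇ x) ∧ zigUp (y ∷ u))) ∧ zigDown (suc k ∷ w)
      ≡⟨ cong (λ b → (b ∧ ((y ≤ᵇ x) ∧ zigUp (y ∷ u))) ∧ zigDown (suc k ∷ w))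
           (sym (Bool.not-involutive (odd (length (y ∷ u))))) ⟩
    (not (odd (length (x ∷ y ∷ u))) ∧ zigDown (x ∷ y ∷ u)) ∧ zigDown (suc k ∷ w) ∎
    where open ≡-Reasoning

  -- Σ of g over the words of length n with letters in {1, …, k + 1} that contain k + 1
  sumWordsWithTop : ℕ → ℕ → (List ℕ → ℕ) → ℕ
  sumWordsWithTop zero    k g = 0
  sumWordsWithTop (suc n) k g =
    sumWords n (suc k) (g ∘ (suc k ∷_)) + sumVals k (λ x → sumWordsWithTop n k (g ∘ (x ∷_)))

  sumWords-suc : ∀ n k g → sumWords n (suc k) g ≡ sumWords n k g + sumWordsWithTop n k g
  sumWords-suc zero    k g = sym (ℕ.+-identityʳ (g []))
  sumWords-suc (suc n) k g = begin
    sumVals k (λ x → sumWords n (suc k) (g ∘ (x ∷_))) + startsWithTop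
      ≡⟨ cong (_+ startsWithTop) (trans (sumVals-cong k (λ x → sumWords-suc n k (g ∘ (x ∷_)))) (sumVals-+ k _ _)) ⟩
    (sumWords (suc n) k g + sumVals k (λ x → sumWordsWithTop n k (g ∘ (x ∷_)))) + startsWithTop
      ≡⟨ +-rearrange (sumWords (suc n) k g) (sumVals k (λ x → sumWordsWithTop n k (g ∘ (x ∷_)))) startsWithTop ⟩
    sumWords (suc n) k g + sumWordsWithTop (suc n) k g ∎
    where
    open ≡-Reasoning
    startsWithTop = sumWords n (suc k) (g ∘ (suc k ∷_))
    +-rearrange : ∀ a b c → a + b + c ≡ a + (c + b)
    +-rearrange = solve-∀

  -- Σ_{i + 1 + j = n} h i j
  Σ-pivot : ℕ → (ℕ → ℕ → ℕ) → ℕ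
  Σ-pivot zero    h = 0
  Σ-pivot (suc n) h = h 0 n + Σ-pivot n (λ i j → h (suc i) j)

  Σ-pivot-cong : ∀ n {h h'} → (∀ i j → h i j ≡ h' i j) → Σ-pivot n h ≡ Σ-pivot n h'
  Σ-pivot-cong zero    h≗h' = refl
  Σ-pivot-cong (suc n) h≗h' = cong₂ _+_ (h≗h' 0 n) (Σ-pivot-cong n (λ i j → h≗h' (suc i) j))

  Σ-pivot-+ : ∀ n h h' → Σ-pivot n (λ i j → h i j + h' i j) ≡ Σ-pivot n h + Σ-pivot n h'
  Σ-pivot-+ zero    h h' = refl
  Σ-pivot-+ (suc n) h h' = trans (cong (_+_ (h 0 n + h' 0 n)) (Σ-pivot-+ n _ _)) (+-interchange (h 0 n) (h' 0 n) _ _)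
    where
    +-interchange : ∀ a b c d → a + b + (c + d) ≡ a + c + (b + d)
    +-interchange = solve-∀

  Σ-pivot-sumVals : ∀ n k (h : ℕ → ℕ → ℕ → ℕ) →
    Σ-pivot n (λ i j → sumVals k (λ x → h x i j)) ≡ sumVals k (λ x → Σ-pivot n (h x))
  Σ-pivot-sumVals zero    k h = sym (sumVals-zero k)
  Σ-pivot-sumVals (suc n) k h =
    trans (cong (_+_ (sumVals k (λ x → h x 0 n))) (Σ-pivot-sumVals n k (λ x i j → h x (suc i) j)))
          (sym (sumVals-+ k (λ x → h x 0 n) (λ x → Σ-pivot n (λ i j → h x (suc i) j))))

  -- Words with a top letter are cut at its first occurrence: a nonempty prefix of
  -- length i + 1 below the top, the top letter, and a suffix of length j.
  sumWordsWithTop-pivot : ∀ n k g →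
    sumVals k (λ x → sumWordsWithTop n k (g ∘ (x ∷_)))
      ≡ Σ-pivot n (λ i j → sumWords (suc i) k (λ u → sumWords j (suc k) (λ w → g (u ++ suc k ∷ w))))
  sumWordsWithTop-pivot zero    k g = sumVals-zero k
  sumWordsWithTop-pivot (suc n) k g = trans (sumVals-+ k _ _)
    (cong (_+_ (sumVals k (λ x → sumWords n (suc k) (λ w → g (x ∷ suc k ∷ w)))))
      (trans (sumVals-cong k (λ x → sumWordsWithTop-pivot n k (g ∘ (x ∷_))))
        (sym (Σ-pivot-sumVals n k (λ x i j →
          sumWords (suc i) k (λ u → sumWords j (suc k) (λ w → g (x ∷ u ++ suc k ∷ w))))))))

  sumWords-around-top : ∀ k i j (p : List ℕ → Bool) (parity : ℕ → Bool) →
    (∀ x u w → All (_≤ k) (x ∷ u) → All (_≤ suc k) w →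
       𝟙 (p (x ∷ u ++ suc k ∷ w)) ≡ (𝟙 (parity (length (x ∷ u))) * 𝟙 (p (x ∷ u))) * 𝟙 (zigUp w)) →
    sumWords (suc i) k (λ u → sumWords j (suc k) (λ w → 𝟙 (p (u ++ suc k ∷ w))))
      ≡ (𝟙 (parity (suc i)) * sumWords (suc i) k (𝟙 ∘ p)) * ups j (suc k)
  sumWords-around-top k i j p parity factorises = begin
    sumWords (suc i) k (λ u → sumWords j (suc k) (λ w → 𝟙 (p (u ++ suc k ∷ w))))
      ≡⟨ sumVals-cong-≤ k (λ x x≤k → sumWords-cong-≤ i k (λ u u≤k →
           trans (sumWords-cong-≤ j (suc k) (λ w w≤k → factorises x u w (x≤k ∷ u≤k) w≤k))
                 (sumWords-*ˡ j (suc k) (𝟙 (parity (length (x ∷ u))) * 𝟙 (p (x ∷ u))) (𝟙 ∘ zigUp)))) ⟩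
    sumWords (suc i) k (λ u → (𝟙 (parity (length u)) * 𝟙 (p u)) * ups j (suc k))
      ≡⟨ sumWords-*ʳ (suc i) k (ups j (suc k)) (λ u → 𝟙 (parity (length u)) * 𝟙 (p u)) ⟩
    sumWords (suc i) k (λ u → 𝟙 (parity (length u)) * 𝟙 (p u)) * ups j (suc k)
      ≡⟨ cong (_* ups j (suc k)) (trans (sumWords-length (suc i) k (λ l u → 𝟙 (parity l) * 𝟙 (p u)))
                                        (sumWords-*ˡ (suc i) k (𝟙 (parity (suc i))) (𝟙 ∘ p))) ⟩
    (𝟙 (parity (suc i)) * sumWords (suc i) k (𝟙 ∘ p)) * ups j (suc k) ∎
    where open ≡-Reasoning

  upsFromTop : ℕ → ℕ → ℕ
  upsFromTop k zero    = 1
  upsFromTop k (suc n) = ups n (suc k)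

  sumWords-upsFromTop : ∀ k n → sumWords n (suc k) (𝟙 ∘ zigUp ∘ (suc k ∷_)) ≡ upsFromTop k n
  sumWords-upsFromTop k zero    = refl
  sumWords-upsFromTop k (suc n) = cong₂ _+_
    (trans (sumVals-cong-≤ k (λ y y≤k →
             trans (sumWords-cong n (suc k) (λ w → cong (λ b → 𝟙 (b ∧ zigDown (y ∷ w))) (≤ᵇ-false (s≤s y≤k))))
                   (sumWords-zero n (suc k))))
           (sumVals-zero k))
    (sumWords-cong-≤ n (suc k) (λ w w≤k →
      cong 𝟙 (trans (cong (_∧ zigDown (suc k ∷ w)) (≤ᵇ-true (ℕ.≤-refl {suc k}))) (zigDown-top (suc k) w w≤k))))

  ups-suc : ∀ k n → ups (suc n) (suc k) ≡
    ups (suc n) k + (upsFromTop k n + Σ-pivot n (λ i j → (𝟙 (odd (suc i)) * ups (suc i) k) * ups j (suc k)))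
  ups-suc k n = trans (sumWords-suc (suc n) k (𝟙 ∘ zigUp)) (cong (_+_ (ups (suc n) k)) (cong₂ _+_
    (sumWords-upsFromTop k n)
    (trans (sumWordsWithTop-pivot n k (𝟙 ∘ zigUp))
           (Σ-pivot-cong n (λ i j → sumWords-around-top k i j zigUp odd factorises)))))
    where
    factorises : ∀ x u w → All (_≤ k) (x ∷ u) → All (_≤ suc k) w →
      𝟙 (zigUp (x ∷ u ++ suc k ∷ w)) ≡ (𝟙 (odd (length (x ∷ u))) * 𝟙 (zigUp (x ∷ u))) * 𝟙 (zigUp w)
    factorises x u w xu≤k w≤k =
      trans (cong 𝟙 (trans (zigUp-around-top k x u w xu≤k) (cong (_ ∧_) (zigDown-top (suc k) w w≤k))))
            (trans (𝟙-∧ _ (zigUp w)) (cong (_* 𝟙 (zigUp w)) (𝟙-∧ (odd (length (x ∷ u))) (zigUp (x ∷ u)))))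

  downs-suc : ∀ k n → downs (suc n) (suc k) ≡
    downs (suc n) k + (ups n (suc k) + Σ-pivot n (λ i j → (𝟙 (not (odd (suc i))) * downs (suc i) k) * ups j (suc k)))
  downs-suc k n = trans (sumWords-suc (suc n) k (𝟙 ∘ zigDown)) (cong (_+_ (downs (suc n) k)) (cong₂ _+_
    (sumWords-cong-≤ n (suc k) (λ w w≤k → cong 𝟙 (zigDown-top (suc k) w w≤k)))
    (trans (sumWordsWithTop-pivot n k (𝟙 ∘ zigDown))
           (Σ-pivot-cong n (λ i j → sumWords-around-top k i j zigDown (not ∘ odd) factorises)))))
    where
    factorises : ∀ x u w → All (_≤ k) (x ∷ u) → All (_≤ suc k) w →
      𝟙 (zigDown (x ∷ u ++ suc k ∷ w)) ≡ (𝟙 (not (odd (length (x ∷ u)))) * 𝟙 (zigDown (x ∷ u))) * 𝟙 (zigUp w)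
    factorises x u w xu≤k w≤k =
      trans (cong 𝟙 (trans (zigDown-around-top k x u w xu≤k) (cong (_ ∧_) (zigDown-top (suc k) w w≤k))))
            (trans (𝟙-∧ _ (zigUp w)) (cong (_* 𝟙 (zigUp w)) (𝟙-∧ (not (odd (length (x ∷ u)))) (zigDown (x ∷ u)))))

  𝟙-parity : ∀ b x y → (𝟙 b * x) * y + (𝟙 (not b) * x) * y ≡ x * y
  𝟙-parity true  x y = trans (ℕ.+-identityʳ _) (cong (_* y) (ℕ.+-identityʳ x))
  𝟙-parity false x y = cong (_* y) (ℕ.+-identityʳ x)

  -- Adding the decompositions of up- and down-words, the parity conditions on the
  -- prefix complement each other, and the down-words starting with the top letter
  -- supply the term i = 0 of the convolution.
  ups-recurrence : ∀ k n → 2 * ups (suc n) (suc k)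
    ≡ 2 * ups (suc n) k + upsFromTop k n + Σ-pivot (suc n) (λ i j → ups i k * ups j (suc k))
  ups-recurrence k n = begin
    2 * ups (suc n) (suc k)
      ≡⟨ cong (_+_ (ups (suc n) (suc k))) (ℕ.+-identityʳ _) ⟩
    ups (suc n) (suc k) + ups (suc n) (suc k)
      ≡⟨ cong₂ _+_ (ups-suc k n) (trans (sym (downs≡ups (suc n) (suc k))) (downs-suc k n)) ⟩
    (ups (suc n) k + (upsFromTop k n + pivotsUp)) + (downs (suc n) k + (ups n (suc k) + pivotsDown))
      ≡⟨ cong (λ d → (ups (suc n) k + (upsFromTop k n + pivotsUp)) + (d + (ups n (suc k) + pivotsDown)))
              (downs≡ups (suc n) k) ⟩
    (ups (suc n) k + (upsFromTop k n + pivotsUp)) + (ups (suc n) k + (ups n (suc k) + pivotsDown))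
      ≡⟨ +-rearrange (ups (suc n) k) (upsFromTop k n) pivotsUp (ups n (suc k)) pivotsDown ⟩
    2 * ups (suc n) k + upsFromTop k n + (ups n (suc k) + (pivotsUp + pivotsDown))
      ≡⟨ cong (λ s → 2 * ups (suc n) k + upsFromTop k n + (s + (pivotsUp + pivotsDown)))
              (sym (ℕ.+-identityʳ (ups n (suc k)))) ⟩
    2 * ups (suc n) k + upsFromTop k n + (1 * ups n (suc k) + (pivotsUp + pivotsDown))
      ≡⟨ cong (λ s → 2 * ups (suc n) k + upsFromTop k n + (1 * ups n (suc k) + s)) parities-merge ⟩
    2 * ups (suc n) k + upsFromTop k n + Σ-pivot (suc n) (λ i j → ups i k * ups j (suc k)) ∎
    where
    open ≡-Reasoning
    pivotsUp   = Σ-pivot n (λ i j → (𝟙 (odd (suc i)) * ups (suc i) k) * ups j (suc k))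
    pivotsDown = Σ-pivot n (λ i j → (𝟙 (not (odd (suc i))) * downs (suc i) k) * ups j (suc k))
    parities-merge : pivotsUp + pivotsDown ≡ Σ-pivot n (λ i j → ups (suc i) k * ups j (suc k))
    parities-merge = trans (sym (Σ-pivot-+ n _ _)) (Σ-pivot-cong n (λ i j →
      trans (cong (λ d → (𝟙 (odd (suc i)) * ups (suc i) k) * ups j (suc k) + (𝟙 (not (odd (suc i))) * d) * ups j (suc k))
                  (downs≡ups (suc i) k))
            (𝟙-parity (odd (suc i)) (ups (suc i) k) (ups j (suc k)))))
    +-rearrange : ∀ a b c d e → (a + (b + c)) + (a + (d + e)) ≡ 2 * a + b + (d + (c + e))
    +-rearrange = solve-∀

open ZigZagWords using (ups; upsFromTop; Σ-pivot; Ω≡ups; ups-recurrence)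

open import Data.Integer as ℤ using (ℤ; _+_; _*_)
import Data.Integer.Properties as ℤ
open import Data.Integer.Tactic.RingSolver using (solve-∀)
open import Data.Maybe using (Maybe; just; nothing)
open import Data.Sum using (inj₁; inj₂)
open import Algebra.Bundles using (RawRing)
open import Algebra.Structures using (IsCommutativeMonoid; IsCommutativeSemiring)
open import Algebra.Solver.Ring.AlmostCommutativeRing
  using (AlmostCommutativeRing; _-Raw-AlmostCommutative⟶_)
open import Relation.Binary.Bundles using (Setoid)
open import Relation.Binary.Structures using (IsEquivalence)
import Relation.Binary.Reasoning.Setoid as SetoidReasoning
open import Relation.Nullary using (yes; no; contradiction)
open import Induction.WellFounded using (WfRec)
open import Data.Nat.Induction using (<-rec)

sumTo-cong : ∀ n {g h : ℕ → ℤ} → (∀ k → g k ≡ h k) → sumTo n g ≡ sumTo n h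
sumTo-cong zero    g≗h = g≗h 0
sumTo-cong (suc n) g≗h = cong₂ _+_ (sumTo-cong n g≗h) (g≗h (suc n))

sumTo-cong-≤ : ∀ n {g h : ℕ → ℤ} → (∀ k → k ≤ n → g k ≡ h k) → sumTo n g ≡ sumTo n h
sumTo-cong-≤ zero    g≗h = g≗h 0 z≤n
sumTo-cong-≤ (suc n) g≗h =
  cong₂ _+_ (sumTo-cong-≤ n (λ k k≤n → g≗h k (ℕ.m≤n⇒m≤1+n k≤n))) (g≗h (suc n) ℕ.≤-refl)

sumTo-unfoldˡ : ∀ n (g : ℕ → ℤ) → sumTo (suc n) g ≡ g 0 + sumTo n (λ k → g (suc k))
sumTo-unfoldˡ zero    g = refl
sumTo-unfoldˡ (suc n) g = trans (cong (_+ g (suc (suc n))) (sumTo-unfoldˡ n g))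
  (ℤ.+-assoc (g 0) (sumTo n (λ k → g (suc k))) (g (suc (suc n))))

sumTo-zero : ∀ n → sumTo n (λ _ → + 0) ≡ + 0
sumTo-zero zero    = refl
sumTo-zero (suc n) = cong (_+ + 0) (sumTo-zero n)

sumTo-+ : ∀ n (g h : ℕ → ℤ) → sumTo n (λ k → g k + h k) ≡ sumTo n g + sumTo n h
sumTo-+ zero    g h = refl
sumTo-+ (suc n) g h = trans (cong (_+ (g (suc n) + h (suc n))) (sumTo-+ n g h))
  (+-interchange (sumTo n g) (sumTo n h) (g (suc n)) (h (suc n)))
  where
  +-interchange : ∀ a b c d → (a + b) + (c + d) ≡ (a + c) + (b + d)
  +-interchange = solve-∀

sumTo-*ˡ : ∀ n c (g : ℕ → ℤ) → sumTo n (λ k → c * g k) ≡ c * sumTo n g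
sumTo-*ˡ zero    c g = refl
sumTo-*ˡ (suc n) c g = trans (cong (_+ c * g (suc n)) (sumTo-*ˡ n c g))
  (sym (ℤ.*-distribˡ-+ c (sumTo n g) (g (suc n))))

sumTo-neg : ∀ n (g : ℕ → ℤ) → sumTo n (λ k → - g k) ≡ - sumTo n g
sumTo-neg zero    g = refl
sumTo-neg (suc n) g = trans (cong (_+ - g (suc n)) (sumTo-neg n g))
  (sym (ℤ.neg-distrib-+ (sumTo n g) (g (suc n))))

shift : Series → Series
shift p k = p (suc k)

scale : ℤ → Series → Series
scale c p k = c * p k

const : ℤ → Series
const c = poly (c ∷ [])

0S 1S : Series
0S = poly []
1S = const (+ 1)

⊛-unfoldˡ : ∀ p q n → (p ⊛ q) (suc n) ≡ p 0 * q (suc n) + (shift p ⊛ q) n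
⊛-unfoldˡ p q n = sumTo-unfoldˡ n (λ k → p k * q (suc n ∸ k))

⊛-unfoldʳ : ∀ p q n → (p ⊛ q) (suc n) ≡ (p ⊛ shift q) n + p (suc n) * q 0
⊛-unfoldʳ p q n = cong₂ _+_
  (sumTo-cong-≤ n (λ k k≤n → cong (λ i → p k * q i) (ℕ.+-∸-assoc 1 k≤n)))
  (cong (λ i → p (suc n) * q i) (ℕ.n∸n≡0 n))

⊛-comm : ∀ p q → p ⊛ q ≐ q ⊛ p
⊛-comm p q zero    = ℤ.*-comm (p 0) (q 0)
⊛-comm p q (suc n) = begin
  (p ⊛ q) (suc n)                 ≡⟨ ⊛-unfoldˡ p q n ⟩
  p 0 * q (suc n) + (shift p ⊛ q) n ≡⟨ cong₂ _+_ (ℤ.*-comm (p 0) (q (suc n))) (⊛-comm (shift p) q n) ⟩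
  q (suc n) * p 0 + (q ⊛ shift p) n ≡⟨ ℤ.+-comm (q (suc n) * p 0) ((q ⊛ shift p) n) ⟩
  (q ⊛ shift p) n + q (suc n) * p 0 ≡⟨ sym (⊛-unfoldʳ q p n) ⟩
  (q ⊛ p) (suc n)                 ∎
  where open ≡-Reasoning

⊛-congʳ : ∀ {p p'} q → p ≐ p' → p ⊛ q ≐ p' ⊛ q
⊛-congʳ q p≐p' n = sumTo-cong n (λ k → cong (_* q (n ∸ k)) (p≐p' k))

⊛-congˡ : ∀ p {q q'} → q ≐ q' → p ⊛ q ≐ p ⊛ q'
⊛-congˡ p q≐q' n = sumTo-cong n (λ k → cong (p k *_) (q≐q' (n ∸ k)))

⊛-distribʳ : ∀ q p p' → (p ⊕ p') ⊛ q ≐ p ⊛ q ⊕ p' ⊛ q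
⊛-distribʳ q p p' n =
  trans (sumTo-cong n (λ k → ℤ.*-distribʳ-+ (q (n ∸ k)) (p k) (p' k))) (sumTo-+ n _ _)

⊛-distribˡ : ∀ p q q' → p ⊛ (q ⊕ q') ≐ p ⊛ q ⊕ p ⊛ q'
⊛-distribˡ p q q' n = trans (⊛-comm p (q ⊕ q') n)
  (trans (⊛-distribʳ p q q' n) (cong₂ _+_ (⊛-comm q p n) (⊛-comm q' p n)))

⊖-distribˡ-⊛ : ∀ p q → (⊖ p) ⊛ q ≐ ⊖ (p ⊛ q)
⊖-distribˡ-⊛ p q n =
  trans (sumTo-cong n (λ k → sym (ℤ.neg-distribˡ-* (p k) (q (n ∸ k))))) (sumTo-neg n _)

scale-⊛ : ∀ c p q → scale c p ⊛ q ≐ scale c (p ⊛ q)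
scale-⊛ c p q n =
  trans (sumTo-cong n (λ k → ℤ.*-assoc c (p k) (q (n ∸ k)))) (sumTo-*ˡ n c _)

shift-⊛ : ∀ p q → shift (p ⊛ q) ≐ scale (p 0) (shift q) ⊕ shift p ⊛ q
shift-⊛ p q = ⊛-unfoldˡ p q

⊛-assoc : ∀ p q r → (p ⊛ q) ⊛ r ≐ p ⊛ (q ⊛ r)
⊛-assoc p q r zero    = ℤ.*-assoc (p 0) (q 0) (r 0)
⊛-assoc p q r (suc n) = begin
  ((p ⊛ q) ⊛ r) (suc n)
    ≡⟨ ⊛-unfoldˡ (p ⊛ q) r n ⟩
  (p 0 * q 0) * r (suc n) + (shift (p ⊛ q) ⊛ r) n
    ≡⟨ cong (_+_ ((p 0 * q 0) * r (suc n))) (⊛-congʳ r (shift-⊛ p q) n) ⟩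
  (p 0 * q 0) * r (suc n) + ((scale (p 0) (shift q) ⊕ shift p ⊛ q) ⊛ r) n
    ≡⟨ cong (_+_ ((p 0 * q 0) * r (suc n))) (trans (⊛-distribʳ r (scale (p 0) (shift q)) (shift p ⊛ q) n)
         (cong₂ _+_ (scale-⊛ (p 0) (shift q) r n) (⊛-assoc (shift p) q r n))) ⟩
  (p 0 * q 0) * r (suc n) + (p 0 * (shift q ⊛ r) n + (shift p ⊛ (q ⊛ r)) n)
    ≡⟨ regroup (p 0) (q 0) (r (suc n)) ((shift q ⊛ r) n) ((shift p ⊛ (q ⊛ r)) n) ⟩
  p 0 * (q 0 * r (suc n) + (shift q ⊛ r) n) + (shift p ⊛ (q ⊛ r)) n
    ≡⟨ cong (λ t → p 0 * t + (shift p ⊛ (q ⊛ r)) n) (sym (⊛-unfoldˡ q r n)) ⟩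
  p 0 * (q ⊛ r) (suc n) + (shift p ⊛ (q ⊛ r)) n
    ≡⟨ sym (⊛-unfoldˡ p (q ⊛ r) n) ⟩
  (p ⊛ (q ⊛ r)) (suc n) ∎
  where
  open ≡-Reasoning
  regroup : ∀ a b c d e → (a * b) * c + (a * d + e) ≡ a * (b * c + d) + e
  regroup = solve-∀

poly-∷-⊛ : ∀ c cs q n → (poly (c ∷ cs) ⊛ q) (suc n) ≡ c * q (suc n) + (poly cs ⊛ q) n
poly-∷-⊛ c cs q = ⊛-unfoldˡ (poly (c ∷ cs)) q

0S-⊛ : ∀ q → 0S ⊛ q ≐ 0S
0S-⊛ q n = sumTo-zero n

const-⊛ : ∀ c q n → (const c ⊛ q) n ≡ c * q n
const-⊛ c q zero    = refl
const-⊛ c q (suc n) =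
  trans (poly-∷-⊛ c [] q n) (trans (cong (_+_ (c * q (suc n))) (0S-⊛ q n)) (ℤ.+-identityʳ _))

1S-⊛ : ∀ q → 1S ⊛ q ≐ q
1S-⊛ q n = trans (const-⊛ (+ 1) q n) (ℤ.*-identityˡ (q n))

Y-⊛ : ∀ q n → (Y ⊛ q) (suc n) ≡ q n
Y-⊛ q n = trans (poly-∷-⊛ (+ 0) (+ 1 ∷ []) q n)
  (trans (ℤ.+-identityˡ _) (trans (const-⊛ (+ 1) q n) (ℤ.*-identityˡ (q n))))

≐-isEquivalence : IsEquivalence _≐_
≐-isEquivalence = record
  { refl  = λ n → refl
  ; sym   = λ p≐q n → sym (p≐q n)
  ; trans = λ p≐q q≐r n → trans (p≐q n) (q≐r n)
  }

≐-setoid : Setoid _ _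
≐-setoid = record { isEquivalence = ≐-isEquivalence }

⊕-cong : ∀ {p p' q q'} → p ≐ p' → q ≐ q' → p ⊕ q ≐ p' ⊕ q'
⊕-cong p≐p' q≐q' n = cong₂ _+_ (p≐p' n) (q≐q' n)

⊕-congˡ : ∀ p {q q'} → q ≐ q' → p ⊕ q ≐ p ⊕ q'
⊕-congˡ p q≐q' = ⊕-cong {p} (λ _ → refl) q≐q'

⊕-congʳ : ∀ q {p p'} → p ≐ p' → p ⊕ q ≐ p' ⊕ q
⊕-congʳ q p≐p' = ⊕-cong {q = q} p≐p' (λ _ → refl)

⊖-cong : ∀ {p q} → p ≐ q → ⊖ p ≐ ⊖ q
⊖-cong p≐q n = cong -_ (p≐q n)

⊕-isCommutativeMonoid : IsCommutativeMonoid _≐_ _⊕_ 0S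
⊕-isCommutativeMonoid = record
  { isMonoid = record
    { isSemigroup = record
      { isMagma = record { isEquivalence = ≐-isEquivalence ; ∙-cong = ⊕-cong }
      ; assoc   = λ p q r n → ℤ.+-assoc (p n) (q n) (r n)
      }
    ; identity = (λ p n → ℤ.+-identityˡ (p n)) , (λ p n → ℤ.+-identityʳ (p n))
    }
  ; comm = λ p q n → ℤ.+-comm (p n) (q n)
  }

⊕-⊛-isCommutativeSemiring : IsCommutativeSemiring _≐_ _⊕_ _⊛_ 0S 1S
⊕-⊛-isCommutativeSemiring = record
  { isSemiring = record
    { isSemiringWithoutAnnihilatingZero = record
      { +-isCommutativeMonoid = ⊕-isCommutativeMonoid
      ; *-cong     = λ {p} {p'} {q} p≐p' q≐q' n →
                       trans (⊛-congʳ q p≐p' n) (⊛-congˡ p' q≐q' n)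
      ; *-assoc    = ⊛-assoc
      ; *-identity = 1S-⊛ , (λ p n → trans (⊛-comm p 1S n) (1S-⊛ p n))
      ; distrib    = ⊛-distribˡ , ⊛-distribʳ
      }
    ; zero = 0S-⊛ , (λ p n → trans (⊛-comm p 0S n) (0S-⊛ p n))
    }
  ; *-comm = ⊛-comm
  }

seriesRing : AlmostCommutativeRing _ _
seriesRing = record
  { Carrier = Series ; _≈_ = _≐_ ; _+_ = _⊕_ ; _*_ = _⊛_ ; -_ = ⊖_ ; 0# = 0S ; 1# = 1S
  ; isAlmostCommutativeRing = record
    { isCommutativeSemiring = ⊕-⊛-isCommutativeSemiring
    ; -‿cong        = ⊖-cong
    ; -‿*-distribˡ  = ⊖-distribˡ-⊛
    ; -‿+-comm      = λ p q n → sym (ℤ.neg-distrib-+ (p n) (q n))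
    }
  }

ℤ-rawRing : RawRing _ _
ℤ-rawRing = record
  { Carrier = ℤ ; _≈_ = _≡_ ; _+_ = _+_ ; _*_ = _*_ ; -_ = -_ ; 0# = + 0 ; 1# = + 1 }

const-homomorphism : ℤ-rawRing -Raw-AlmostCommutative⟶ seriesRing
const-homomorphism = record
  { ⟦_⟧    = const
  ; +-homo = λ a b → λ { zero → refl ; (suc n) → refl }
  ; *-homo = λ a b → λ { zero → refl
                       ; (suc n) → sym (trans (const-⊛ a (const b) (suc n)) (ℤ.*-zeroʳ a)) }
  ; -‿homo = λ a → λ { zero → refl ; (suc n) → refl }
  ; 0-homo = λ { zero → refl ; (suc n) → refl }
  ; 1-homo = λ n → refl
  }

const-≟ : ∀ a b → Maybe (const a ≐ const b)
const-≟ a b with a ℤ.≟ b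
... | yes refl = just (λ n → refl)
... | no  _    = nothing

open import Algebra.Solver.Ring ℤ-rawRing seriesRing const-homomorphism const-≟
  using (solve; _:=_; con; _:+_; _:*_; _:-_; :-_)

⊛-lowest : ∀ p q n → (∀ {k} → k < n → p k ≡ + 0) → (p ⊛ q) n ≡ p n * q 0
⊛-lowest p q zero    _       = refl
⊛-lowest p q (suc n) p<n≡0 = begin
  (p ⊛ q) (suc n)                      ≡⟨ ⊛-unfoldʳ p q n ⟩
  (p ⊛ shift q) n + p (suc n) * q 0    ≡⟨ cong (_+ p (suc n) * q 0) lower-terms≡0 ⟩
  + 0 + p (suc n) * q 0                ≡⟨ ℤ.+-identityˡ _ ⟩
  p (suc n) * q 0                      ∎
  where
  open ≡-Reasoning
  lower-terms≡0 : (p ⊛ shift q) n ≡ + 0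
  lower-terms≡0 = trans
    (sumTo-cong-≤ n (λ k k≤n → trans (cong (_* shift q (n ∸ k)) (p<n≡0 (s≤s k≤n))) (ℤ.*-zeroˡ (shift q (n ∸ k)))))
    (sumTo-zero n)

-- The lowest nonzero coefficient of p - q would survive in a ⊛ (p - q), as ℤ has no zero divisors.
⊛-cancelˡ : ∀ a {p q} → a 0 ≢ + 0 → a ⊛ p ≐ a ⊛ q → p ≐ q
⊛-cancelˡ a {p} {q} a₀≢0 ap≐aq n = ℤ.i-j≡0⇒i≡j (p n) (q n) (<-rec _ vanish n)
  where
  d : Series
  d = p ⊕ ⊖ q
  da≐0 : d ⊛ a ≐ 0S
  da≐0 k = begin
    (d ⊛ a) k                  ≡⟨ solve 3 (λ a p q → (p :- q) :* a := a :* p :- a :* q) (λ _ → refl) a p q k ⟩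
    (a ⊛ p) k + - (a ⊛ q) k    ≡⟨ cong (λ t → t + - (a ⊛ q) k) (ap≐aq k) ⟩
    (a ⊛ q) k + - (a ⊛ q) k    ≡⟨ ℤ.+-inverseʳ ((a ⊛ q) k) ⟩
    + 0                        ∎
    where open ≡-Reasoning
  vanish : ∀ k → WfRec _<_ (λ i → d i ≡ + 0) k → d k ≡ + 0
  vanish k d<k≡0 with ℤ.i*j≡0⇒i≡0∨j≡0 (d k) (trans (sym (⊛-lowest d a k d<k≡0)) (da≐0 k))
  ... | inj₁ dₖ≡0 = dₖ≡0
  ... | inj₂ a₀≡0 = contradiction a₀≡0 a₀≢0

c2 : Series
c2 = const (+ 2)

F-ups : ∀ k → F k ≐ (λ n → + ups n k)
F-ups k n = cong +_ (Ω≡ups n k)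

⊛-Σ-pivot : ∀ (f g : ℕ → ℕ) n → ((λ i → + f i) ⊛ (λ j → + g j)) n ≡ + Σ-pivot (suc n) (λ i j → f i ℕ.* g j)
⊛-Σ-pivot f g zero    = trans (sym (ℤ.pos-* (f 0) (g 0))) (cong +_ (sym (ℕ.+-identityʳ _)))
⊛-Σ-pivot f g (suc n) = begin
  ((λ i → + f i) ⊛ (λ j → + g j)) (suc n)
    ≡⟨ ⊛-unfoldˡ (λ i → + f i) (λ j → + g j) n ⟩
  + f 0 * + g (suc n) + ((λ i → + f (suc i)) ⊛ (λ j → + g j)) n
    ≡⟨ cong₂ _+_ (sym (ℤ.pos-* (f 0) (g (suc n)))) (⊛-Σ-pivot (f ∘ suc) g n) ⟩
  + (f 0 ℕ.* g (suc n)) + + Σ-pivot (suc n) (λ i j → f (suc i) ℕ.* g j)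
    ≡⟨ sym (ℤ.pos-+ (f 0 ℕ.* g (suc n)) _) ⟩
  + Σ-pivot (suc (suc n)) (λ i j → f i ℕ.* g j) ∎
  where open ≡-Reasoning

F-upsFromTop : ∀ k n → Y (suc n) + (Y ⊛ F (suc k)) n ≡ + upsFromTop k n
F-upsFromTop k zero    = refl
F-upsFromTop k (suc n) = trans (ℤ.+-identityˡ _) (trans (Y-⊛ (F (suc k)) n) (F-ups (suc k) n))

F-suc-recurrence : ∀ k →
  c2 ⊛ F (suc k) ≐ Y ⊕ c2 ⊛ F k ⊕ Y ⊛ (Y ⊛ F (suc k)) ⊕ Y ⊛ (F k ⊛ F (suc k))
F-suc-recurrence k zero    = refl
F-suc-recurrence k (suc n) = begin
  (c2 ⊛ F (suc k)) (suc n)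
    ≡⟨ trans (const-⊛ (+ 2) (F (suc k)) (suc n))
             (trans (cong (λ x → + 2 * x) (F-ups (suc k) (suc n))) (sym (ℤ.pos-* 2 (ups (suc n) (suc k))))) ⟩
  + (2 ℕ.* ups (suc n) (suc k))
    ≡⟨ cong +_ (ups-recurrence k n) ⟩
  + (2 ℕ.* ups (suc n) k ℕ.+ upsFromTop k n ℕ.+ pivots)
    ≡⟨ trans (ℤ.pos-+ (2 ℕ.* ups (suc n) k ℕ.+ upsFromTop k n) pivots)
             (cong (_+ + pivots) (trans (ℤ.pos-+ (2 ℕ.* ups (suc n) k) (upsFromTop k n))
                                        (cong (_+ + upsFromTop k n) (ℤ.pos-* 2 (ups (suc n) k))))) ⟩
  + 2 * + ups (suc n) k + + upsFromTop k n + + pivots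
    ≡⟨ cong₂ (λ a b → a + b + + pivots)
             (sym (trans (const-⊛ (+ 2) (F k) (suc n)) (cong (λ x → + 2 * x) (F-ups k (suc n)))))
             (sym (F-upsFromTop k n)) ⟩
  (c2 ⊛ F k) (suc n) + (Y (suc n) + (Y ⊛ F (suc k)) n) + + pivots
    ≡⟨ cong (λ c → (c2 ⊛ F k) (suc n) + (Y (suc n) + (Y ⊛ F (suc k)) n) + c) (sym F-product) ⟩
  (c2 ⊛ F k) (suc n) + (Y (suc n) + (Y ⊛ F (suc k)) n) + (F k ⊛ F (suc k)) n
    ≡⟨ +-rearrange ((c2 ⊛ F k) (suc n)) (Y (suc n)) ((Y ⊛ F (suc k)) n) ((F k ⊛ F (suc k)) n) ⟩
  Y (suc n) + (c2 ⊛ F k) (suc n) + (Y ⊛ F (suc k)) n + (F k ⊛ F (suc k)) n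
    ≡⟨ sym (cong₂ (λ a b → Y (suc n) + (c2 ⊛ F k) (suc n) + a + b)
                  (Y-⊛ (Y ⊛ F (suc k)) n) (Y-⊛ (F k ⊛ F (suc k)) n)) ⟩
  (Y ⊕ c2 ⊛ F k ⊕ Y ⊛ (Y ⊛ F (suc k)) ⊕ Y ⊛ (F k ⊛ F (suc k))) (suc n) ∎
  where
  open ≡-Reasoning
  pivots = Σ-pivot (suc n) (λ i j → ups i k ℕ.* ups j (suc k))
  F-product : (F k ⊛ F (suc k)) n ≡ + pivots
  F-product = trans (⊛-congʳ (F (suc k)) (F-ups k) n)
    (trans (⊛-congˡ (λ i → + ups i k) (F-ups (suc k)) n) (⊛-Σ-pivot (λ i → ups i k) (λ j → ups j (suc k)) n))
  +-rearrange : ∀ a b c d → a + (b + c) + d ≡ b + a + c + d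
  +-rearrange = solve-∀

F-suc-relation : ∀ k → F (suc k) ⊛ (c2 ⊕ ⊖ (Y ⊛ Y) ⊕ ⊖ (Y ⊛ F k)) ≐ Y ⊕ c2 ⊛ F k
F-suc-relation k = begin
  H ⊛ (c2 ⊕ ⊖ (Y ⊛ Y) ⊕ ⊖ (Y ⊛ G))
    ≈⟨ solve 3 (λ H Y G → H :* (con (+ 2) :- Y :* Y :- Y :* G)
                         := con (+ 2) :* H :- Y :* (Y :* H) :- Y :* (G :* H)) (λ _ → refl) H Y G ⟩
  c2 ⊛ H ⊕ ⊖ (Y ⊛ (Y ⊛ H)) ⊕ ⊖ (Y ⊛ (G ⊛ H))
    ≈⟨ ⊕-congʳ _ (⊕-congʳ _ (F-suc-recurrence k)) ⟩
  Y ⊕ c2 ⊛ G ⊕ Y ⊛ (Y ⊛ H) ⊕ Y ⊛ (G ⊛ H) ⊕ ⊖ (Y ⊛ (Y ⊛ H)) ⊕ ⊖ (Y ⊛ (G ⊛ H))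
    ≈⟨ solve 3 (λ H Y G → Y :+ con (+ 2) :* G :+ Y :* (Y :* H) :+ Y :* (G :* H) :- Y :* (Y :* H) :- Y :* (G :* H)
                         := Y :+ con (+ 2) :* G) (λ _ → refl) H Y G ⟩
  Y ⊕ c2 ⊛ G ∎
  where
  open SetoidReasoning ≐-setoid
  G = F k
  H = F (suc k)

-- The factor 4 - y² appears when F (m + 1) is eliminated between the relations
-- for F (m + 1) and F (m + 2); it is cancelled at the end.
F-two-step : ∀ m → F (suc (suc m)) ⊛ (1S ⊕ ⊖ (Y ⊛ Y) ⊕ ⊖ (Y ⊛ F m)) ≐ Y ⊕ F m
F-two-step m = ⊛-cancelˡ (const (+ 4) ⊕ ⊖ (Y ⊛ Y)) (λ ()) (begin
  (const (+ 4) ⊕ ⊖ (Y ⊛ Y)) ⊛ (K ⊛ (1S ⊕ ⊖ (Y ⊛ Y) ⊕ ⊖ (Y ⊛ G)))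
    ≈⟨ solve 3 (λ K Y G → (con (+ 4) :- Y :* Y) :* (K :* (con (+ 1) :- Y :* Y :- Y :* G))
                         := K :* ((con (+ 2) :- Y :* Y) :* (con (+ 2) :- Y :* Y :- Y :* G)
                                  :- Y :* (Y :+ con (+ 2) :* G))) (λ _ → refl) K Y G ⟩
  K ⊛ ((c2 ⊕ ⊖ (Y ⊛ Y)) ⊛ A ⊕ ⊖ (Y ⊛ (Y ⊕ c2 ⊛ G)))
    ≈⟨ ⊛-congˡ K (⊕-congˡ ((c2 ⊕ ⊖ (Y ⊛ Y)) ⊛ A) (⊖-cong (⊛-congˡ Y (λ n → sym (F-suc-relation m n))))) ⟩
  K ⊛ ((c2 ⊕ ⊖ (Y ⊛ Y)) ⊛ A ⊕ ⊖ (Y ⊛ (H ⊛ A)))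
    ≈⟨ solve 4 (λ K H Y A → K :* ((con (+ 2) :- Y :* Y) :* A :- Y :* (H :* A))
                           := A :* (K :* (con (+ 2) :- Y :* Y :- Y :* H))) (λ _ → refl) K H Y A ⟩
  A ⊛ (K ⊛ (c2 ⊕ ⊖ (Y ⊛ Y) ⊕ ⊖ (Y ⊛ H)))
    ≈⟨ ⊛-congˡ A (F-suc-relation (suc m)) ⟩
  A ⊛ (Y ⊕ c2 ⊛ H)
    ≈⟨ solve 3 (λ H Y A → A :* (Y :+ con (+ 2) :* H) := Y :* A :+ con (+ 2) :* (H :* A)) (λ _ → refl) H Y A ⟩
  Y ⊛ A ⊕ c2 ⊛ (H ⊛ A)
    ≈⟨ ⊕-congˡ (Y ⊛ A) (⊛-congˡ c2 (F-suc-relation m)) ⟩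
  Y ⊛ A ⊕ c2 ⊛ (Y ⊕ c2 ⊛ G)
    ≈⟨ solve 2 (λ Y G → Y :* (con (+ 2) :- Y :* Y :- Y :* G) :+ con (+ 2) :* (Y :+ con (+ 2) :* G)
                       := (con (+ 4) :- Y :* Y) :* (Y :+ G)) (λ _ → refl) Y G ⟩
  (const (+ 4) ⊕ ⊖ (Y ⊛ Y)) ⊛ (Y ⊕ G) ∎)
  where
  open SetoidReasoning ≐-setoid
  G = F m
  H = F (suc m)
  K = F (suc (suc m))
  A = c2 ⊕ ⊖ (Y ⊛ Y) ⊕ ⊖ (Y ⊛ G)

oneMinusY : Series
oneMinusY = poly (+ 1 ∷ - (+ 1) ∷ [])

oneMinusY² : Series
oneMinusY² = poly (+ 1 ∷ + 0 ∷ - (+ 1) ∷ [])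

-- F 0 = 1, so P 0 = Q 0 = 1 starts the recursion on the even indices.
P Q : ℕ → Series
P zero          = 1S
P (suc zero)    = 1S
P (suc (suc m)) = P m ⊕ Y ⊛ Q m
Q zero          = 1S
Q (suc zero)    = oneMinusY
Q (suc (suc m)) = ⊖ (Y ⊛ P m) ⊕ (oneMinusY² ⊛ Q m)

F-zero : F 0 ≐ 1S
F-zero zero    = refl
F-zero (suc n) = refl

oneMinusY≐ : oneMinusY ≐ 1S ⊕ ⊖ Y
oneMinusY≐ zero          = refl
oneMinusY≐ (suc zero)    = refl
oneMinusY≐ (suc (suc n)) = refl

oneMinusY²≐ : oneMinusY² ≐ 1S ⊕ ⊖ (Y ⊛ Y)
oneMinusY²≐ zero                = refl
oneMinusY²≐ (suc zero)          = refl
oneMinusY²≐ (suc (suc zero))    = refl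
oneMinusY²≐ (suc (suc (suc n))) = cong (λ c → + 0 + - c) (sym (Y-⊛ Y (suc (suc n))))

oneMinusY²-⊛ : ∀ p n → (oneMinusY² ⊛ p) (suc (suc n)) ≡ p (suc (suc n)) + - p n
oneMinusY²-⊛ p n = begin
  (oneMinusY² ⊛ p) (suc (suc n))
    ≡⟨ poly-∷-⊛ (+ 1) _ p (suc n) ⟩
  + 1 * p (suc (suc n)) + (poly (+ 0 ∷ - (+ 1) ∷ []) ⊛ p) (suc n)
    ≡⟨ cong (_+_ (+ 1 * p (suc (suc n)))) (trans (poly-∷-⊛ (+ 0) _ p n)
                                               (cong (_+_ (+ 0 * p (suc n))) (const-⊛ (- (+ 1)) p n))) ⟩
  + 1 * p (suc (suc n)) + (+ 0 * p (suc n) + - (+ 1) * p n)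
    ≡⟨ simplify (p (suc (suc n))) (p (suc n)) (p n) ⟩
  p (suc (suc n)) + - p n ∎
  where
  open ≡-Reasoning
  simplify : ∀ a b c → + 1 * a + (+ 0 * b + - (+ 1) * c) ≡ a + - c
  simplify = solve-∀

QF≐P : ∀ m → Q m ⊛ F m ≐ P m
QF≐P zero n = trans (1S-⊛ (F 0) n) (F-zero n)
QF≐P (suc zero) = ⊛-cancelˡ (c2 ⊕ Y) (λ ()) (begin
  (c2 ⊕ Y) ⊛ (oneMinusY ⊛ F 1)
    ≈⟨ ⊛-congˡ (c2 ⊕ Y) (⊛-congʳ (F 1) oneMinusY≐) ⟩
  (c2 ⊕ Y) ⊛ ((1S ⊕ ⊖ Y) ⊛ F 1)
    ≈⟨ solve 2 (λ Y F₁ → (con (+ 2) :+ Y) :* ((con (+ 1) :- Y) :* F₁)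
                        := F₁ :* (con (+ 2) :- Y :* Y :- Y :* con (+ 1))) (λ _ → refl) Y (F 1) ⟩
  F 1 ⊛ (c2 ⊕ ⊖ (Y ⊛ Y) ⊕ ⊖ (Y ⊛ 1S))
    ≈⟨ ⊛-congˡ (F 1) (⊕-congˡ (c2 ⊕ ⊖ (Y ⊛ Y)) (⊖-cong (⊛-congˡ Y (λ n → sym (F-zero n))))) ⟩
  F 1 ⊛ (c2 ⊕ ⊖ (Y ⊛ Y) ⊕ ⊖ (Y ⊛ F 0))
    ≈⟨ F-suc-relation 0 ⟩
  Y ⊕ c2 ⊛ F 0
    ≈⟨ ⊕-congˡ Y (⊛-congˡ c2 F-zero) ⟩
  Y ⊕ c2 ⊛ 1S
    ≈⟨ solve 1 (λ Y → Y :+ con (+ 2) :* con (+ 1) := (con (+ 2) :+ Y) :* con (+ 1)) (λ _ → refl) Y ⟩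
  (c2 ⊕ Y) ⊛ 1S ∎)
  where open SetoidReasoning ≐-setoid
QF≐P (suc (suc m)) = begin
  (⊖ (Y ⊛ P m) ⊕ oneMinusY² ⊛ Q m) ⊛ F (suc (suc m))
    ≈⟨ ⊛-congʳ (F (suc (suc m))) (⊕-cong (⊖-cong (⊛-congˡ Y (λ n → sym (QF≐P m n))))
                                          (⊛-congʳ (Q m) oneMinusY²≐)) ⟩
  (⊖ (Y ⊛ (Q m ⊛ F m)) ⊕ (1S ⊕ ⊖ (Y ⊛ Y)) ⊛ Q m) ⊛ F (suc (suc m))
    ≈⟨ solve 4 (λ Y Qₘ Fₘ K → (:- (Y :* (Qₘ :* Fₘ)) :+ (con (+ 1) :- Y :* Y) :* Qₘ) :* K
                             := Qₘ :* (K :* (con (+ 1) :- Y :* Y :- Y :* Fₘ)))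
               (λ _ → refl) Y (Q m) (F m) (F (suc (suc m))) ⟩
  Q m ⊛ (F (suc (suc m)) ⊛ (1S ⊕ ⊖ (Y ⊛ Y) ⊕ ⊖ (Y ⊛ F m)))
    ≈⟨ ⊛-congˡ (Q m) (F-two-step m) ⟩
  Q m ⊛ (Y ⊕ F m)
    ≈⟨ solve 3 (λ Y Qₘ Fₘ → Qₘ :* (Y :+ Fₘ) := Qₘ :* Fₘ :+ Y :* Qₘ) (λ _ → refl) Y (Q m) (F m) ⟩
  Q m ⊛ F m ⊕ Y ⊛ Q m
    ≈⟨ ⊕-congʳ (Y ⊛ Q m) (QF≐P m) ⟩
  P m ⊕ Y ⊛ Q m ∎
  where open SetoidReasoning ≐-setoid

Degrees : ℕ → Set
Degrees m = HasDegree (Q m) m × HasDegree (P m) (m ∸ 1)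

degrees-step : ∀ m → Degrees m → Degrees (suc (suc m))
degrees-step m ((Qₘ-lead , Qₘ-high) , (_ , Pₘ-high)) = (Q-lead , Q-high) , (P-lead , P-high)
  where
  Pₘ-above : ∀ i → m < i → P m i ≡ + 0
  Pₘ-above i m<i = Pₘ-high i (ℕ.≤-<-trans (ℕ.m∸n≤m m 1) m<i)

  Q-coeff : ∀ i → Q (suc (suc m)) (suc (suc i)) ≡ - P m (suc i) + (Q m (suc (suc i)) + - Q m i)
  Q-coeff i = cong₂ _+_ (cong -_ (Y-⊛ (P m) (suc i))) (oneMinusY²-⊛ (Q m) i)

  P-coeff : ∀ i → P (suc (suc m)) (suc i) ≡ P m (suc i) + Q m i
  P-coeff i = cong (_+_ (P m (suc i))) (Y-⊛ (Q m) i)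

  Q-lead : Q (suc (suc m)) (suc (suc m)) ≢ + 0
  Q-lead Q≡0 = Qₘ-lead (ℤ.neg-injective (trans (sym (begin
    Q (suc (suc m)) (suc (suc m))                          ≡⟨ Q-coeff m ⟩
    - P m (suc m) + (Q m (suc (suc m)) + - Q m m)          ≡⟨ cong₂ (λ p q → - p + (q + - Q m m))
                                                                 (Pₘ-above (suc m) (ℕ.n<1+n m))
                                                                 (Qₘ-high (suc (suc m)) (ℕ.m<n⇒m<1+n (ℕ.n<1+n m))) ⟩
    + 0 + (+ 0 + - Q m m)                                  ≡⟨ trans (ℤ.+-identityˡ _) (ℤ.+-identityˡ _) ⟩
    - Q m m                                                ∎)) Q≡0))
    where open ≡-Reasoning

  Q-high : ∀ i → suc (suc m) < i → Q (suc (suc m)) i ≡ + 0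
  Q-high (suc (suc i)) (s≤s (s≤s m<i)) = trans (Q-coeff i) (cong₂ (λ p q → - p + q)
    (Pₘ-above (suc i) (ℕ.m<n⇒m<1+n m<i))
    (cong₂ (λ q q' → q + - q') (Qₘ-high (suc (suc i)) (ℕ.m<n⇒m<1+n (ℕ.m<n⇒m<1+n m<i))) (Qₘ-high i m<i)))

  P-lead : P (suc (suc m)) (suc m) ≢ + 0
  P-lead P≡0 = Qₘ-lead (trans (sym (begin
    P (suc (suc m)) (suc m)   ≡⟨ P-coeff m ⟩
    P m (suc m) + Q m m       ≡⟨ cong (_+ Q m m) (Pₘ-above (suc m) (ℕ.n<1+n m)) ⟩
    + 0 + Q m m               ≡⟨ ℤ.+-identityˡ (Q m m) ⟩
    Q m m                     ∎)) P≡0)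
    where open ≡-Reasoning

  P-high : ∀ i → suc m < i → P (suc (suc m)) i ≡ + 0
  P-high (suc i) (s≤s m<i) = trans (P-coeff i) (cong₂ _+_ (Pₘ-above (suc i) (ℕ.m<n⇒m<1+n m<i)) (Qₘ-high i m<i))

degrees : ∀ m → Degrees m
degrees zero          = ((λ ()) , λ { (suc i) _ → refl }) , ((λ ()) , λ { (suc i) _ → refl })
degrees (suc zero)    = ((λ ()) , λ { (suc zero) (s≤s ()) ; (suc (suc i)) _ → refl }) , ((λ ()) , λ { (suc i) _ → refl })
degrees (suc (suc m)) = degrees-step m (degrees m)

corollary3p16 : Σ (ℕ → Series) λ P → Σ (ℕ → Series) λ Q →
    (∀ m → m ≥ 1 → (Q m ⊛ F m ≐ P m) × HasDegree (Q m) m × HasDegree (P m) (m ∸ 1))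
  × (P 1 ≐ poly (+ 1 ∷ []))
  × (Q 1 ≐ poly (+ 1 ∷ - (+ 1) ∷ []))
  × (P 2 ≐ poly (+ 1 ∷ + 1 ∷ []))
  × (Q 2 ≐ poly (+ 1 ∷ - (+ 1) ∷ - (+ 1) ∷ []))
  × (∀ m → m ≥ 1 →
        (P (suc (suc m)) ≐ P m ⊕ Y ⊛ Q m)
      × (Q (suc (suc m)) ≐ ⊖ (Y ⊛ P m) ⊕ (poly (+ 1 ∷ + 0 ∷ - (+ 1) ∷ []) ⊛ Q m)))
corollary3p16 =
    P , Q , (λ m _ → QF≐P m , degrees m) , (λ _ → refl) , (λ _ → refl) , P₂ , Q₂
  , (λ m _ → (λ _ → refl) , (λ _ → refl))
  where
  P₂ : P 2 ≐ poly (+ 1 ∷ + 1 ∷ [])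
  P₂ zero          = refl
  P₂ (suc zero)    = refl
  P₂ (suc (suc n)) = cong (_+_ (+ 0)) (Y-⊛ 1S (suc n))
  Q₂ : Q 2 ≐ poly (+ 1 ∷ - (+ 1) ∷ - (+ 1) ∷ [])
  Q₂ zero                = refl
  Q₂ (suc zero)          = refl
  Q₂ (suc (suc zero))    = refl
  Q₂ (suc (suc (suc n))) = cong₂ (λ p q → - p + q) (Y-⊛ 1S (suc (suc n))) (oneMinusY²-⊛ 1S (suc n))
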